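{- Let $w\in\{0,1,2\}^*$ be a square-free word with $|w|\ge 2$, and let $M(w)=\lfloor (|w|+1)/2\rfloor$. Then the position $M(w)$ is a critical point of $w$.
   Context: A word is square-free if it has no factor $vv$ with $v$ nonempty. A position of $w$ is an integer $p$ with $1\le p<|w|$; write $w=xy$ with $|x|=p$. A nonempty word $u$ is a repetition word of $w$ at $p$ if there are (possibly empty) words $x',y'$ with ($u=x'x$ or $x=x'u$) and ($u=yy'$ or $y=uy'$). $\mathrm{per}(w,p)$ is the minimal length of a repetition word at $p$. An integer $q$ with $1\le q\le |w|$ is a period of $w$ if $w$ is a prefix of $z^n$ for some $n$, where $z$ is the prefix of $w$ of length $q$; $\mathrm{per}(w)$ is the minimal period. A position $p$ is critical if $\mathrm{per}(w,p)=\mathrm{per}(w)$. -}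

module Defs where

open import Data.Nat using (ℕ; suc; _≤_; _<_; _+_; _/_)
open import Data.Fin using (Fin)
open import Data.List using (List; []; _++_; length; take; drop; concat; replicate)
open import Data.Product using (Σ; ∃; ∃-syntax; _×_; _,_)
open import Data.Sum using (_⊎_)
open import Relation.Binary.PropositionalEquality using (_≡_; _≢_)
open import Relation.Nullary using (¬_)

Word : Set
Word = List (Fin 3)

SquareFree : Word → Set
SquareFree w = ¬ (∃[ a ] ∃[ v ] ∃[ b ] (v ≢ [] × w ≡ a ++ (v ++ v) ++ b))

Position : Word → ℕ → Set
Position w p = 1 ≤ p × p < length w

RepWord : Word → ℕ → Word → Set
RepWord w p u =
  u ≢ [] ×
  ((∃[ x' ] u ≡ x' ++ take p w) ⊎ (∃[ x' ] take p w ≡ x' ++ u)) ×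
  ((∃[ y' ] u ≡ drop p w ++ y') ⊎ (∃[ y' ] drop p w ≡ u ++ y'))

LocalPeriodIs : Word → ℕ → ℕ → Set
LocalPeriodIs w p n =
  (∃[ u ] (RepWord w p u × length u ≡ n)) ×
  (∀ u → RepWord w p u → n ≤ length u)

IsPeriod : Word → ℕ → Set
IsPeriod w q =
  1 ≤ q × q ≤ length w ×
  (∃[ k ] ∃[ t ] w ++ t ≡ concat (replicate k (take q w)))

PeriodIs : Word → ℕ → Set
PeriodIs w n = IsPeriod w n × (∀ q → IsPeriod w q → n ≤ q)

Critical : Word → ℕ → Set
Critical w p = Position w p × (∃[ n ] (LocalPeriodIs w p n × PeriodIs w n))

M : Word → ℕ
M w = (length w + 1) / 2

-- Let p = M(w), so that |w| ≤ 2p ≤ |w| + 1. Square-freeness forces every period q of w to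
-- satisfy |w| < 2q, hence q ≥ p, and every repetition word u at p to have length at least p;
-- then u overlaps both x = w[..p) and y = w[p..) as u = x′x = yy′. Overlaps of length r ≤ |w|
-- correspond exactly to periods r ≥ p of w, so the least period is also the least length of a
-- repetition word at p.
module Submission where

open import Defs
open import Data.Nat using (ℕ; zero; suc; _+_; _*_; _∸_; _/_; _%_; _≤_; _<_; z≤n; s≤s; s≤s⁻¹; _≤?_; _<?_)
open import Data.Nat.Properties
open import Data.Nat.DivMod using (m≡m%n+[m/n]*n; m%n<n)
open import Data.Fin using () renaming (_≟_ to _≟ᶠ_)
open import Data.List using (List; []; _∷_; _++_; length; take; drop)
open import Data.List.Properties
  using ( length-++; ++-assoc; ++-identityʳ; ++-conicalˡ; take++drop≡id; length-take; length-drop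
        ; take-take; drop-drop; drop-all; ≡-dec)
open import Data.Product using (∃-syntax; ∃₂; _×_; _,_; proj₁; proj₂)
open import Data.Sum using (_⊎_; inj₁; inj₂)
open import Relation.Nullary using (¬_; Dec; yes; no; contradiction)
open import Relation.Nullary.Decidable using (_×-dec_)
open import Relation.Binary.PropositionalEquality
open ≡-Reasoning

module _ {A : Set} where

  take-length-++ : (xs ys : List A) → take (length xs) (xs ++ ys) ≡ xs
  take-length-++ []       ys = refl
  take-length-++ (x ∷ xs) ys = cong (x ∷_) (take-length-++ xs ys)

  drop-length-++ : (xs ys : List A) → drop (length xs) (xs ++ ys) ≡ ys
  drop-length-++ []       ys = refl
  drop-length-++ (x ∷ xs) ys = drop-length-++ xs ys

  take-++ˡ : ∀ k (xs ys : List A) → k ≤ length xs → take k (xs ++ ys) ≡ take k xs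
  take-++ˡ zero    xs       ys _         = refl
  take-++ˡ (suc k) (x ∷ xs) ys (s≤s k≤) = cong (x ∷_) (take-++ˡ k xs ys k≤)

  drop-++ˡ : ∀ k (xs ys : List A) → k ≤ length xs → drop k (xs ++ ys) ≡ drop k xs ++ ys
  drop-++ˡ zero    xs       ys _         = refl
  drop-++ˡ (suc k) (x ∷ xs) ys (s≤s k≤) = drop-++ˡ k xs ys k≤

  length-take-≤ : ∀ k (xs : List A) → k ≤ length xs → length (take k xs) ≡ k
  length-take-≤ k xs k≤ = trans (length-take k xs) (m≤n⇒m⊓n≡m k≤)

  take-take-≤ : ∀ {k m} (xs : List A) → k ≤ m → take k (take m xs) ≡ take k xs
  take-take-≤ {k} {m} xs k≤m = trans (take-take k m xs) (cong (λ j → take j xs) (m≤n⇒m⊓n≡m k≤m))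

  length≤0⇒≡[] : (xs : List A) → length xs ≤ 0 → xs ≡ []
  length≤0⇒≡[] [] _ = refl

  ++-prefix : ∀ (xs ys zs ws : List A) → xs ++ ys ≡ zs ++ ws → length xs ≤ length zs →
              xs ≡ take (length xs) zs
  ++-prefix xs ys zs ws eq le = begin
    xs                          ≡⟨ take-length-++ xs ys ⟨
    take (length xs) (xs ++ ys) ≡⟨ cong (take (length xs)) eq ⟩
    take (length xs) (zs ++ ws) ≡⟨ take-++ˡ (length xs) zs ws le ⟩
    take (length xs) zs         ∎

  xs≡ys++zs⇒xs≡ys : ∀ {xs ys zs : List A} → xs ≡ ys ++ zs → length xs ≤ length ys → xs ≡ ys
  xs≡ys++zs⇒xs≡ys {xs} {ys} {zs} refl le =
    trans (cong (ys ++_) (length≤0⇒≡[] zs (+-cancelˡ-≤ (length ys) _ 0 le′))) (++-identityʳ ys)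
    where
    le′ : length ys + length zs ≤ length ys + 0
    le′ = subst₂ _≤_ (length-++ ys) (sym (+-identityʳ _)) le

  xs≡ys++zs⇒xs≡zs : ∀ {xs ys zs : List A} → xs ≡ ys ++ zs → length xs ≤ length zs → xs ≡ zs
  xs≡ys++zs⇒xs≡zs {xs} {ys} {zs} refl le =
    cong (_++ zs) (length≤0⇒≡[] ys (+-cancelʳ-≤ (length zs) _ 0 (subst (_≤ length zs) (length-++ ys) le)))

module _ {P : ℕ → Set} (P? : ∀ k → Dec (P k)) where

  least-witness : ∀ {n} → P n → ∃[ m ] (P m × (∀ k → P k → m ≤ k))
  least-witness {n} pn = search n 0 (λ _ ()) (subst P (sym (+-identityʳ n)) pn)
    where
    search : ∀ d i → (∀ k → k < i → ¬ P k) → P (d + i) → ∃[ m ] (P m × (∀ k → P k → m ≤ k))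
    search d       i none-below pd+i with P? i
    search d       i none-below pd+i | yes pi = i , pi , λ k pk → ≮⇒≥ (λ k<i → none-below k k<i pk)
    search zero    i none-below pi   | no ¬pi = contradiction pi ¬pi
    search (suc d) i none-below pd+i | no ¬pi = search d (suc i) none-below′ (subst P (sym (+-suc d i)) pd+i)
      where
      none-below′ : ∀ k → k < suc i → ¬ P k
      none-below′ k k<1+i with m<1+n⇒m<n∨m≡n k<1+i
      ... | inj₁ k<i  = none-below k k<i
      ... | inj₂ refl = ¬pi

HasPeriod : {A : Set} → List A → ℕ → Set
HasPeriod w q = drop q w ≡ take (length w ∸ q) w

hasPeriod? : ∀ (w : Word) q → Dec (HasPeriod w q)
hasPeriod? w q = ≡-dec _≟ᶠ_ (drop q w) (take (length w ∸ q) w)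

hasPeriod-length : {A : Set} (w : List A) → HasPeriod w (length w)
hasPeriod-length w = begin
  drop (length w) w            ≡⟨ drop-all (length w) w ≤-refl ⟩
  []                           ≡⟨⟩
  take 0 w                     ≡⟨ cong (λ k → take k w) (n∸n≡0 (length w)) ⟨
  take (length w ∸ length w) w ∎

length-take-period : ∀ {w : Word} {q} → IsPeriod w q → length (take q w) ≡ q
length-take-period {w} {q} (_ , q≤n , _) = length-take-≤ q w q≤n

isPeriod-unfold : ∀ {w : Word} {q} → IsPeriod w q →
                  q ≡ length w ⊎ ∃₂ λ t r → w ++ t ≡ take q w ++ take q w ++ r
isPeriod-unfold {w} (1≤q , q≤n , zero , t , eq) =
  contradiction (cong length (++-conicalˡ w t eq)) (λ n≡0 → <⇒≱ (≤-trans 1≤q q≤n) (≤-reflexive n≡0))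
isPeriod-unfold {w} {q} isp@(_ , q≤n , suc zero , t , eq) = inj₁ (≤-antisym q≤n n≤q)
  where
  n≤q : length w ≤ q
  n≤q = m+n≤o⇒m≤o (length w) (≤-reflexive (begin
    length w + length t     ≡⟨ length-++ w ⟨
    length (w ++ t)         ≡⟨ cong length eq ⟩
    length (take q w ++ []) ≡⟨ cong length (++-identityʳ (take q w)) ⟩
    length (take q w)       ≡⟨ length-take-period isp ⟩
    q                       ∎))
isPeriod-unfold (_ , _ , suc (suc _) , t , eq) = inj₂ (t , _ , eq)

hasPeriod⇒isPeriod : ∀ {w : Word} {q} → 1 ≤ q → q ≤ length w → length w ≤ q + q →
                     HasPeriod w q → IsPeriod w q
hasPeriod⇒isPeriod {w} {q} 1≤q q≤n n≤2q per = 1≤q , q≤n , 2 , drop c z , eq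
  where
  z = take q w
  c = length w ∸ q
  c≤q : c ≤ q
  c≤q = m≤n+o⇒m∸n≤o (length w) q n≤2q
  eq : w ++ drop c z ≡ z ++ (z ++ [])
  eq = begin
    w ++ drop c z                ≡⟨ cong (_++ drop c z) (take++drop≡id q w) ⟨
    (z ++ drop q w) ++ drop c z  ≡⟨ cong (λ v → (z ++ v) ++ drop c z) per ⟩
    (z ++ take c w) ++ drop c z  ≡⟨ ++-assoc z _ _ ⟩
    z ++ (take c w ++ drop c z)  ≡⟨ cong (λ v → z ++ (v ++ drop c z)) (take-take-≤ w c≤q) ⟨
    z ++ (take c z ++ drop c z)  ≡⟨ cong (z ++_) (take++drop≡id c z) ⟩
    z ++ z                       ≡⟨ cong (z ++_) (++-identityʳ z) ⟨
    z ++ (z ++ [])               ∎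

isPeriod⇒hasPeriod : ∀ {w : Word} {q} → IsPeriod w q → length w ≤ q + q → HasPeriod w q
isPeriod⇒hasPeriod {w} {q} isp@(_ , q≤n , _) n≤2q with isPeriod-unfold isp
... | inj₁ refl = hasPeriod-length w
... | inj₂ (t , r , eq) = begin
    drop q w                    ≡⟨ ++-prefix (drop q w) t z r shifted |drop|≤|z| ⟩
    take (length (drop q w)) z  ≡⟨ cong (λ k → take k z) (length-drop q w) ⟩
    take (length w ∸ q) z       ≡⟨ take-take-≤ w n∸q≤q ⟩
    take (length w ∸ q) w       ∎
  where
  z = take q w
  |z|≡q = length-take-period isp
  n∸q≤q = m≤n+o⇒m∸n≤o (length w) q n≤2q
  |drop|≤|z| : length (drop q w) ≤ length z
  |drop|≤|z| = subst₂ _≤_ (sym (length-drop q w)) (sym |z|≡q) n∸q≤q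
  shifted : drop q w ++ t ≡ z ++ r
  shifted = begin
    drop q w ++ t                 ≡⟨ drop-++ˡ q w t q≤n ⟨
    drop q (w ++ t)               ≡⟨ cong (drop q) eq ⟩
    drop q (z ++ z ++ r)          ≡⟨ cong (λ k → drop k (z ++ z ++ r)) |z|≡q ⟨
    drop (length z) (z ++ z ++ r) ≡⟨ drop-length-++ z (z ++ r) ⟩
    z ++ r                        ∎

squareFree⇒length<period+period : ∀ {w : Word} {q} → SquareFree w → IsPeriod w q → length w < q + q
squareFree⇒length<period+period {w} {q} sf isp@(1≤q , _) with isPeriod-unfold isp
... | inj₁ refl = m<m+n q 1≤q
... | inj₂ (t , r , eq) with q + q ≤? length w
...   | no 2q≰n = ≰⇒> 2q≰n
...   | yes 2q≤n = contradiction ([] , z , drop (q + q) w , z≢[] , w≡zz++) sf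
  where
  z = take q w
  |zz|≡2q : length (z ++ z) ≡ q + q
  |zz|≡2q = trans (length-++ z) (cong₂ _+_ (length-take-period isp) (length-take-period isp))
  z≢[] : z ≢ []
  z≢[] z≡[] = <⇒≱ 1≤q (≤-reflexive (trans (sym (length-take-period isp)) (cong length z≡[])))
  zz≡take : z ++ z ≡ take (q + q) w
  zz≡take = begin
    z ++ z                   ≡⟨ ++-prefix (z ++ z) r w t (trans (++-assoc z z r) (sym eq)) |zz|≤n ⟩
    take (length (z ++ z)) w ≡⟨ cong (λ k → take k w) |zz|≡2q ⟩
    take (q + q) w           ∎
    where
    |zz|≤n : length (z ++ z) ≤ length w
    |zz|≤n = subst (_≤ length w) (sym |zz|≡2q) 2q≤n
  w≡zz++ : w ≡ [] ++ (z ++ z) ++ drop (q + q) w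
  w≡zz++ = trans (sym (take++drop≡id (q + q) w)) (cong (_++ drop (q + q) w) (sym zz≡take))

module _ {A : Set} (x y : List A) where

  overlap⇒hasPeriod : ∀ {u x′ y′} → u ≡ x′ ++ x → u ≡ y ++ y′ → length u ≤ length (x ++ y) →
                      HasPeriod (x ++ y) (length u)
  overlap⇒hasPeriod {u} {x′} {y′} u≡x′x u≡yy′ |u|≤n = begin
    drop (length u) (x ++ y)                   ≡⟨ cong (λ k → drop k (x ++ y)) |u|≡|x|+a ⟩
    drop (length x + a) (x ++ y)               ≡⟨ drop-drop (length x) a (x ++ y) ⟨
    drop a (drop (length x) (x ++ y))          ≡⟨ cong (drop a) (drop-length-++ x y) ⟩
    drop a y                                   ≡⟨ take-length-++ (drop a y) y′ ⟨
    take (length (drop a y)) (drop a y ++ y′)  ≡⟨ cong₂ take (length-drop a y) x≡ ⟩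
    take c x                                   ≡⟨ take-++ˡ c x y c≤|x| ⟨
    take c (x ++ y)                            ≡⟨ cong (λ k → take k (x ++ y)) n∸|u|≡c ⟨
    take (length (x ++ y) ∸ length u) (x ++ y) ∎
    where
    a = length x′
    c = length y ∸ a
    |u|≡|x|+a : length u ≡ length x + a
    |u|≡|x|+a = trans (cong length u≡x′x) (trans (length-++ x′) (+-comm a (length x)))
    |u|≡|y|+|y′| : length u ≡ length y + length y′
    |u|≡|y|+|y′| = trans (cong length u≡yy′) (length-++ y)
    a≤|y| : a ≤ length y
    a≤|y| = +-cancelˡ-≤ (length x) a (length y) (subst₂ _≤_ |u|≡|x|+a (length-++ x) |u|≤n)
    c≤|x| : c ≤ length x
    c≤|x| = m≤n+o⇒m∸n≤o (length y) a
              (subst (length y ≤_) (trans (sym |u|≡|y|+|y′|) (trans |u|≡|x|+a (+-comm (length x) a))) (m≤m+n _ _))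
    n∸|u|≡c : length (x ++ y) ∸ length u ≡ c
    n∸|u|≡c = trans (cong₂ _∸_ (length-++ x) |u|≡|x|+a) ([m+n]∸[m+o]≡n∸o (length x) (length y) a)
    x≡ : drop a y ++ y′ ≡ x
    x≡ = begin
      drop a y ++ y′   ≡⟨ drop-++ˡ a y y′ a≤|y| ⟨
      drop a (y ++ y′) ≡⟨ cong (drop a) (trans (sym u≡yy′) u≡x′x) ⟩
      drop a (x′ ++ x) ≡⟨ drop-length-++ x′ x ⟩
      x                ∎

  hasPeriod⇒overlap : ∀ {r} → length x ≤ r → length y ≤ r → r ≤ length (x ++ y) → HasPeriod (x ++ y) r →
                      ∃₂ λ x′ y′ → x′ ++ x ≡ y ++ y′ × length (x′ ++ x) ≡ r
  hasPeriod⇒overlap {r} |x|≤r |y|≤r r≤n per = take a y , drop c x , x′x≡yy′ , length-overlap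
    where
    a = r ∸ length x
    c = length (x ++ y) ∸ r
    a≤|y| : a ≤ length y
    a≤|y| = m≤n+o⇒m∸n≤o r (length x) (subst (r ≤_) (length-++ x) r≤n)
    c≤|x| : c ≤ length x
    c≤|x| = m≤n+o⇒m∸n≤o (length (x ++ y)) r
              (subst₂ _≤_ (sym (length-++ x)) (+-comm (length x) r) (+-monoʳ-≤ (length x) |y|≤r))
    dropped≡taken : drop a y ≡ take c x
    dropped≡taken = begin
      drop a y                          ≡⟨ cong (drop a) (drop-length-++ x y) ⟨
      drop a (drop (length x) (x ++ y)) ≡⟨ drop-drop (length x) a (x ++ y) ⟩
      drop (length x + a) (x ++ y)      ≡⟨ cong (λ k → drop k (x ++ y)) (m+[n∸m]≡n |x|≤r) ⟩
      drop r (x ++ y)                   ≡⟨ per ⟩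
      take c (x ++ y)                   ≡⟨ take-++ˡ c x y c≤|x| ⟩
      take c x                          ∎
    x′x≡yy′ : take a y ++ x ≡ y ++ drop c x
    x′x≡yy′ = begin
      take a y ++ x                      ≡⟨ cong (take a y ++_) (take++drop≡id c x) ⟨
      take a y ++ (take c x ++ drop c x) ≡⟨ ++-assoc (take a y) _ _ ⟨
      (take a y ++ take c x) ++ drop c x ≡⟨ cong (λ v → (take a y ++ v) ++ drop c x) dropped≡taken ⟨
      (take a y ++ drop a y) ++ drop c x ≡⟨ cong (_++ drop c x) (take++drop≡id a y) ⟩
      y ++ drop c x                      ∎
    length-overlap : length (take a y ++ x) ≡ r
    length-overlap = begin
      length (take a y ++ x)         ≡⟨ length-++ (take a y) ⟩
      length (take a y) + length x   ≡⟨ cong (_+ length x) (length-take-≤ a y a≤|y|) ⟩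
      a + length x                   ≡⟨ m∸n+n≡m |x|≤r ⟩
      r                              ∎

module _ {A : Set} {x u : List A} where

  suffix-of-longer : (∃[ x′ ] u ≡ x′ ++ x) ⊎ (∃[ x′ ] x ≡ x′ ++ u) → length x ≤ length u →
                     ∃[ x′ ] u ≡ x′ ++ x
  suffix-of-longer (inj₁ x-suffix)    _       = x-suffix
  suffix-of-longer (inj₂ (_ , x≡x′u)) |x|≤|u| = [] , sym (xs≡ys++zs⇒xs≡zs x≡x′u |x|≤|u|)

  prefix-of-longer : (∃[ x′ ] u ≡ x ++ x′) ⊎ (∃[ x′ ] x ≡ u ++ x′) → length x ≤ length u →
                     ∃[ x′ ] u ≡ x ++ x′
  prefix-of-longer (inj₁ x-prefix)    _       = x-prefix
  prefix-of-longer (inj₂ (_ , x≡ux′)) |x|≤|u| =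
    [] , trans (sym (xs≡ys++zs⇒xs≡ys x≡ux′ |x|≤|u|)) (sym (++-identityʳ x))

-- A repetition word lying inside the word on both sides of p would give a square.
squareFree⇒repWord-long : ∀ {w p u} → SquareFree w → RepWord w p u →
                          length (take p w) ≤ length u ⊎ length (drop p w) < length u
squareFree⇒repWord-long {w} {p} {u} sf (_ , inj₁ (x′ , u≡x′x) , _) =
  inj₁ (subst (length (take p w) ≤_) (sym (trans (cong length u≡x′x) (length-++ x′))) (m≤n+m _ _))
squareFree⇒repWord-long {w} {p} {u} sf (u≢[] , inj₂ (x′ , x≡x′u) , right) = right-case right
  where
  x = take p w
  y = drop p w
  no-square : ∀ {y′} → y ≡ u ++ y′ → length x ≤ length u ⊎ length y < length u
  no-square {y′} y≡uy′ = contradiction (x′ , u , y′ , u≢[] , square) sf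
    where
    square : w ≡ x′ ++ (u ++ u) ++ y′
    square = begin
      w                        ≡⟨ take++drop≡id p w ⟨
      x ++ y                   ≡⟨ cong₂ _++_ x≡x′u y≡uy′ ⟩
      (x′ ++ u) ++ (u ++ y′)   ≡⟨ ++-assoc x′ u (u ++ y′) ⟩
      x′ ++ (u ++ (u ++ y′))   ≡⟨ cong (x′ ++_) (++-assoc u u y′) ⟨
      x′ ++ (u ++ u) ++ y′     ∎
  right-case : (∃[ y′ ] u ≡ y ++ y′) ⊎ (∃[ y′ ] y ≡ u ++ y′) →
               length x ≤ length u ⊎ length y < length u
  right-case (inj₂ (_ , y≡uy′)) = no-square y≡uy′
  right-case (inj₁ (y′ , u≡yy′)) with length y <? length u
  ... | yes |y|<|u| = inj₂ |y|<|u|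
  ... | no |y|≮|u|  = no-square (trans (sym u≡y) (sym (++-identityʳ u)))
    where
    u≡y : u ≡ y
    u≡y = xs≡ys++zs⇒xs≡ys u≡yy′ (≮⇒≥ |y|≮|u|)

module BalancedPosition (w : Word) (p : ℕ) (sf : SquareFree w) (pos : Position w p)
                        (n≤p+p : length w ≤ p + p) (p+p≤1+n : p + p ≤ suc (length w)) where

  private
    x y : Word
    x = take p w
    y = drop p w

    1≤p : 1 ≤ p
    1≤p = proj₁ pos

    p≤n : p ≤ length w
    p≤n = <⇒≤ (proj₂ pos)

    |x|≡p : length x ≡ p
    |x|≡p = length-take-≤ p w p≤n

    |y|≤p : length y ≤ p
    |y|≤p = subst (_≤ p) (sym (length-drop p w)) (m≤n+o⇒m∸n≤o (length w) p n≤p+p)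

    p≤1+|y| : p ≤ suc (length y)
    p≤1+|y| = +-cancelˡ-≤ p p (suc (length y)) (subst (p + p ≤_) 1+n≡p+1+|y| p+p≤1+n)
      where
      1+n≡p+1+|y| : suc (length w) ≡ p + suc (length y)
      1+n≡p+1+|y| = begin
        suc (length w)           ≡⟨ cong suc (m+[n∸m]≡n p≤n) ⟨
        suc (p + (length w ∸ p)) ≡⟨ +-suc p _ ⟨
        p + suc (length w ∸ p)   ≡⟨ cong (λ k → p + suc k) (length-drop p w) ⟨
        p + suc (length y)       ∎

    |xy|≡n : length (x ++ y) ≡ length w
    |xy|≡n = cong length (take++drop≡id p w)

  -- For square-free w these are exactly the periods, and unlike IsPeriod this is decidable.
  PeriodFrom : ℕ → Set
  PeriodFrom q = p ≤ q × q ≤ length w × HasPeriod w q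

  periodFrom? : ∀ q → Dec (PeriodFrom q)
  periodFrom? q = (p ≤? q) ×-dec ((q ≤? length w) ×-dec hasPeriod? w q)

  isPeriod⇒periodFrom : ∀ {q} → IsPeriod w q → PeriodFrom q
  isPeriod⇒periodFrom {q} isp@(_ , q≤n , _) = p≤q , q≤n , isPeriod⇒hasPeriod isp (<⇒≤ n<q+q)
    where
    n<q+q : length w < q + q
    n<q+q = squareFree⇒length<period+period sf isp
    p≤q : p ≤ q
    p≤q = ≮⇒≥ (λ q<p → <⇒≱ (+-mono-< q<p q<p) (≤-trans p+p≤1+n n<q+q))

  periodFrom⇒isPeriod : ∀ {q} → PeriodFrom q → IsPeriod w q
  periodFrom⇒isPeriod (p≤q , q≤n , per) =
    hasPeriod⇒isPeriod (≤-trans 1≤p p≤q) q≤n (≤-trans n≤p+p (+-mono-≤ p≤q p≤q)) per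

  repWord-long : ∀ {u} → RepWord w p u → p ≤ length u
  repWord-long rep with squareFree⇒repWord-long sf rep
  ... | inj₁ |x|≤|u| = subst (_≤ _) |x|≡p |x|≤|u|
  ... | inj₂ |y|<|u| = ≤-trans p≤1+|y| |y|<|u|

  repWord⇒periodFrom : ∀ {u} → RepWord w p u → length u ≤ length w → PeriodFrom (length u)
  repWord⇒periodFrom {u} rep@(_ , left , right) |u|≤n =
    p≤|u| , |u|≤n , subst (λ v → HasPeriod v (length u)) (take++drop≡id p w) period
    where
    p≤|u| = repWord-long rep
    period : HasPeriod (x ++ y) (length u)
    period = overlap⇒hasPeriod x y
      (proj₂ (suffix-of-longer left (subst (_≤ length u) (sym |x|≡p) p≤|u|)))
      (proj₂ (prefix-of-longer right (≤-trans |y|≤p p≤|u|)))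
      (subst (length u ≤_) (sym |xy|≡n) |u|≤n)

  periodFrom⇒repWord : ∀ {q} → PeriodFrom q → ∃[ u ] (RepWord w p u × length u ≡ q)
  periodFrom⇒repWord {q} (p≤q , q≤n , per) =
    repetition (hasPeriod⇒overlap x y (subst (_≤ q) (sym |x|≡p) p≤q) (≤-trans |y|≤p p≤q)
                  (subst (q ≤_) (sym |xy|≡n) q≤n) (subst (λ v → HasPeriod v q) (sym (take++drop≡id p w)) per))
    where
    repetition : (∃₂ λ x′ y′ → x′ ++ x ≡ y ++ y′ × length (x′ ++ x) ≡ q) →
                 ∃[ u ] (RepWord w p u × length u ≡ q)
    repetition (x′ , y′ , x′x≡yy′ , |x′x|≡q) =
      x′ ++ x , (x′x≢[] , inj₁ (x′ , refl) , inj₁ (y′ , x′x≡yy′)) , |x′x|≡q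
      where
      x′x≢[] : x′ ++ x ≢ []
      x′x≢[] x′x≡[] =
        <⇒≱ (≤-trans 1≤p p≤q) (≤-reflexive (trans (sym |x′x|≡q) (cong length x′x≡[])))

  critical : Critical w p
  critical with least-witness periodFrom? (p≤n , ≤-refl , hasPeriod-length w)
  ... | m , from-m@(_ , m≤n , _) , m-least =
    pos , m , (periodFrom⇒repWord from-m , local-least) , (periodFrom⇒isPeriod from-m , global-least)
    where
    global-least : ∀ q → IsPeriod w q → m ≤ q
    global-least q isp = m-least q (isPeriod⇒periodFrom isp)
    local-least : ∀ u → RepWord w p u → m ≤ length u
    local-least u rep with length u ≤? length w
    ... | yes |u|≤n = m-least (length u) (repWord⇒periodFrom rep |u|≤n)
    ... | no |u|≰n  = ≤-trans m≤n (<⇒≤ (≰⇒> |u|≰n))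

half-bounds : ∀ n → n ≤ (n + 1) / 2 + (n + 1) / 2 × (n + 1) / 2 + (n + 1) / 2 ≤ suc n
half-bounds n = n≤h+h , h+h≤1+n
  where
  h = (n + 1) / 2
  r = (n + 1) % 2
  1+n≡r+[h+h] : suc n ≡ r + (h + h)
  1+n≡r+[h+h] = begin
    suc n     ≡⟨ +-comm 1 n ⟩
    n + 1     ≡⟨ m≡m%n+[m/n]*n (n + 1) 2 ⟩
    r + h * 2 ≡⟨ cong (r +_) (trans (*-comm h 2) (cong (h +_) (+-identityʳ h))) ⟩
    r + (h + h) ∎
  h+h≤1+n : h + h ≤ suc n
  h+h≤1+n = subst (h + h ≤_) (sym 1+n≡r+[h+h]) (m≤n+m (h + h) r)
  n≤h+h : n ≤ h + h
  n≤h+h = s≤s⁻¹ (subst (_≤ suc (h + h)) (sym 1+n≡r+[h+h]) (+-monoˡ-≤ (h + h) (s≤s⁻¹ (m%n<n (n + 1) 2))))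

balanced-position : ∀ {n h} → 2 ≤ n → n ≤ h + h → h + h ≤ suc n → 1 ≤ h × h < n
balanced-position {h = zero} 2≤n n≤0 _ = contradiction n≤0 (<⇒≱ (≤-trans (s≤s z≤n) 2≤n))
balanced-position {n} {h@(suc _)} 2≤n _ h+h≤1+n = s≤s z≤n , ≰⇒> n≰h
  where
  n≰h : ¬ n ≤ h
  n≰h n≤h = <⇒≱ 2≤n (+-cancelˡ-≤ n n 1 n+n≤n+1)
    where
    n+n≤n+1 : n + n ≤ n + 1
    n+n≤n+1 = ≤-trans (+-mono-≤ n≤h n≤h) (subst (h + h ≤_) (+-comm 1 n) h+h≤1+n)

mainTheorem5 : (w : Word) → SquareFree w → 2 ≤ length w → Critical w (M w)
mainTheorem5 w sf 2≤n =
  BalancedPosition.critical w (M w) sf (balanced-position 2≤n n≤M+M M+M≤1+n) n≤M+M M+M≤1+n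
  where
  n≤M+M : length w ≤ M w + M w
  n≤M+M = proj₁ (half-bounds (length w))
  M+M≤1+n : M w + M w ≤ suc (length w)
  M+M≤1+n = proj₂ (half-bounds (length w))
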